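{- Let $A,B$ be sets and $(S,\gamma)$ a $\mathbb{T}_A$-residual $\mathbb{T}_B$-comodel. Then the homomorphic extension $\mathsf{tr}^\dagger\colon T_A(S)\to\mathbf{Top}(A^{\mathbb{N}},B^{\mathbb{N}})$ of the trace function $\mathsf{tr}\colon S\to\mathbf{Top}(A^{\mathbb{N}},B^{\mathbb{N}})$ is the unique map of $\mathbb{T}_A$-$\mathbb{T}_B$-bimodels from the bimodel $\mathcal{T}_A(S)$ associated to $(S,\gamma)$ to the bimodel $E_{AB}$.
   Context: $T_A(V)$ is the set of well-founded $A$-ary branching trees with leaves in $V$ (leaves $v$, nodes $\mathsf{read}(\lambda a.\,t_a)$); it is the free $A$-ary magma on $V$ (an $A$-ary magma is a set $X$ with $\xi\colon X^A\to X$). For a function $f$ from $V$ to a magma, $f^\dagger$ is its unique homomorphic extension to $T_A(V)$. A $\mathbb{T}_A$-$\mathbb{T}_B$-bimodel is an $A$-ary magma $\mathcal{K}$ with a magma homomorphism $\delta\colon\mathcal{K}\to B\cdot\mathcal{K}$ into the $B$-fold coproduct of magmas; maps of bimodels are magma homomorphisms $f$ with $\delta'f=(B\cdot f)\delta$. For free magmas take $B\cdot T_A(V)=T_A(B\times V)$ with $b$-th coprojection relabelling each leaf $v$ as $(b,v)$. A $\mathbb{T}_A$-residual $\mathbb{T}_B$-comodel is a set $S$ with $\gamma\colon S\to T_A(B\times S)$; its associated bimodel $\mathcal{T}_A(S)$ is $T_A(S)$ with $\delta=\gamma^\dagger\colon T_A(S)\to T_A(B\times S)$. Streams carry the product of discrete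 topologies, $\partial$ is the shift. For $t\in T_A(V)$, $\langle t\rangle\colon A^{\mathbb{N}}\to V\times A^{\mathbb{N}}$ is given by $\langle v\rangle(\vec a)=(v,\vec a)$, $\langle\mathsf{read}(\lambda a.\,t_a)\rangle(\vec a)=\langle t_{a_0}\rangle(\partial\vec a)$. Writing $\langle\gamma(s)\rangle(\vec a)=(\mathsf{hd}(s,\vec a),\mathsf{next}(s,\vec a),\mathsf{tl}(s,\vec a))$, the trace $\mathsf{tr}(s)\colon A^{\mathbb{N}}\to B^{\mathbb{N}}$ is defined coinductively by $(\mathsf{tr}(s)(\vec a))_0=\mathsf{hd}(s,\vec a)$, $\partial(\mathsf{tr}(s)(\vec a))=\mathsf{tr}(\mathsf{next}(s,\vec a))(\mathsf{tl}(s,\vec a))$; each $\mathsf{tr}(s)$ is continuous. $E_{AB}$ is the bimodel whose underlying set is the set $\mathbf{Top}(A^{\mathbb{N}},B^{\mathbb{N}})$ of continuous maps, with magma operation $\mathsf{split}(\vec f)(\vec a)=f_{a_0}(\partial\vec a)$, and with $\delta$ the composite of postcomposition with the homeomorphism $B^{\mathbb{N}}\to B\times B^{\mathbb{N}}$, $\vec b\mapsto(b_0,\partial\vec b)$, and the inverse of the magma isomorphism $B\cdot\mathbf{Top}(A^{\mathbb{N}},B^{\mathbb{N}})\to\mathbf{Top}(A^{\mathbb{N}},B\times B^{\mathbb{N}})$ whose $b$-th component is $f\mapsto(\vec a\mapsto(b,f(\vec a)))$. -}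

module Defs where

open import Data.Nat using (ℕ; zero; suc; _<_; z≤n; s≤s)
open import Data.Product using (Σ; _×_; _,_; proj₁; proj₂)
open import Relation.Binary.PropositionalEquality using (_≡_; refl)

Stream : Set → Set
Stream A = ℕ → A

∂ : {A : Set} → Stream A → Stream A
∂ a n = a (suc n)

data T (A V : Set) : Set where
  leaf : V → T A V
  read : (A → T A V) → T A V

ext : {A V X : Set} → ((A → X) → X) → (V → X) → T A V → X
ext ξ f (leaf v)  = f v
ext ξ f (read ts) = ξ (λ a → ext ξ f (ts a))

Agree : {A : Set} → ℕ → Stream A → Stream A → Set
Agree k a a' = ∀ i → i < k → a' i ≡ a i

-- g : A^ℕ → X (X discrete) is continuous (locally constant) at a
LC : {A X : Set} → (Stream A → X) → Stream A → Set
LC g a = Σ ℕ λ k → ∀ a' → Agree k a a' → g a' ≡ g a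

Continuous : {A B : Set} → (Stream A → Stream B) → Set
Continuous f = ∀ a n → LC (λ x → f x n) a

ContinuousP : {A B : Set} → (Stream A → B × Stream B) → Set
ContinuousP f = ∀ a → LC (λ x → proj₁ (f x)) a × (∀ n → LC (λ x → proj₂ (f x) n) a)

record Top (A B : Set) : Set where
  constructor cont
  field
    fn     : Stream A → Stream B
    isCont : Continuous fn
open Top public

-- Top(A^ℕ, B × B^ℕ)  (≅ B · Top(A^ℕ, B^ℕ) as magmas)
record TopP (A B : Set) : Set where
  constructor contP
  field
    fnP     : Stream A → B × Stream B
    isContP : ContinuousP fnP
open TopP public

_≈_ : {A B : Set} → Top A B → Top A B → Set
f ≈ g = ∀ a n → fn f a n ≡ fn g a n

_≈P_ : {A B : Set} → TopP A B → TopP A B → Set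
f ≈P g = ∀ a → (proj₁ (fnP f a) ≡ proj₁ (fnP g a)) × (∀ n → proj₂ (fnP f a) n ≡ proj₂ (fnP g a) n)

splitLC : {A X : Set} (g : A → Stream A → X) (a : Stream A) →
          LC (g (a 0)) (∂ a) → LC (λ x → g (x 0) (∂ x)) a
splitLC g a (k , h) = suc k , λ a' ag → go a' ag (ag 0 (s≤s z≤n))
  where
  go : ∀ a' → Agree (suc k) a a' → a' 0 ≡ a 0 → g (a' 0) (∂ a') ≡ g (a 0) (∂ a)
  go a' ag e with a' 0 | e
  ... | .(a 0) | refl = h (∂ a') (λ i i<k → ag (suc i) (s≤s i<k))

split : {A B : Set} → (A → Top A B) → Top A B
split fs = cont (λ a → fn (fs (a 0)) (∂ a))
                (λ a n → splitLC (λ c x → fn (fs c) x n) a (isCont (fs (a 0)) (∂ a) n))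

splitP : {A B : Set} → (A → TopP A B) → TopP A B
splitP fs = contP (λ a → fnP (fs (a 0)) (∂ a))
  (λ a → splitLC (λ c x → proj₁ (fnP (fs c) x)) a (proj₁ (isContP (fs (a 0)) (∂ a)))
       , λ n → splitLC (λ c x → proj₂ (fnP (fs c) x) n) a (proj₂ (isContP (fs (a 0)) (∂ a)) n))

-- The bimodel E_AB: δ_E is postcomposition with b ↦ (b₀, ∂b), landing in
-- Top(A^ℕ, B × B^ℕ) ≅ B · E_AB; the b-th coprojection is f ↦ (a ↦ (b, f a)).

δE : {A B : Set} → Top A B → TopP A B
δE f = contP (λ a → fn f a 0 , ∂ (fn f a)) (λ a → isCont f a 0 , λ n → isCont f a (suc n))

ι : {A B : Set} → B → Top A B → TopP A B
ι b f = contP (λ a → b , fn f a) (λ a → (0 , λ _ _ → refl) , isCont f a)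

⟨_⟩ : {A V : Set} → T A V → Stream A → V × Stream A
⟨ leaf v ⟩ a  = v , a
⟨ read ts ⟩ a = ⟨ ts (a 0) ⟩ (∂ a)

tr : {A B S : Set} → (S → T A (B × S)) → S → Stream A → Stream B
tr γ s a zero    = proj₁ (proj₁ (⟨ γ s ⟩ a))
tr γ s a (suc n) = tr γ (proj₂ (proj₁ (⟨ γ s ⟩ a))) (proj₂ (⟨ γ s ⟩ a)) n

δT : {A B S : Set} → (S → T A (B × S)) → T A S → T A (B × S)
δT γ = ext read γ

-- B · g : T_A(B × S) = B · T_A(S) → B · E_AB, the magma map with
-- (B · g) ∘ ι_b = ι'_b ∘ g, i.e. the extension of (b , s) ↦ ι'_b (g (leaf s))
Bdot : {A B S : Set} → (T A S → Top A B) → T A (B × S) → TopP A B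
Bdot g = ext splitP (λ bs → ι (proj₁ bs) (g (leaf (proj₂ bs))))

IsMagmaHom : {A B S : Set} → (T A S → Top A B) → Set
IsMagmaHom {A} {B} {S} g = ∀ (ts : A → T A S) → g (read ts) ≈ split (λ a → g (ts a))

IsBimodelMap : {A B S : Set} → (S → T A (B × S)) → (T A S → Top A B) → Set
IsBimodelMap γ g = IsMagmaHom g × (∀ t → δE (g t) ≈P Bdot g (δT γ t))

{-# OPTIONS --safe #-}
module Submission where

-- Running a tree t on an input stream consumes only finitely many letters (the
-- depth of the path taken), so each output letter of a trace depends on a finite
-- prefix of the input: traces are continuous. On a leaf s, the δ-equation of a
-- bimodel map g says that g (leaf s) emits the letter b that γ s outputs on the
-- input and then behaves like g (leaf s') on the remaining input; this is exactly
-- the recursion defining tr γ s, so g and tr† agree on leaves by induction on the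
-- output position, and hence everywhere, both being magma homomorphisms.

open import Defs
open import Data.Product using (Σ; _×_; _,_; proj₁; proj₂)
open import Data.Nat using (ℕ; zero; suc; _+_; _≤_; _<_; z≤n; s≤s)
open import Data.Nat.Properties using (≤-trans; m≤m+n; +-monoʳ-<)
open import Relation.Binary.PropositionalEquality using (_≡_; refl; sym; trans; cong)

Agree-≤ : {A : Set} {m n : ℕ} {a a' : Stream A} → m ≤ n → Agree n a a' → Agree m a a'
Agree-≤ m≤n ag i i<m = ag i (≤-trans i<m m≤n)

Agree-head : {A : Set} {k : ℕ} {a a' : Stream A} → Agree (suc k) a a' → a' 0 ≡ a 0
Agree-head ag = ag 0 (s≤s z≤n)

Agree-∂ : {A : Set} {k : ℕ} {a a' : Stream A} → Agree (suc k) a a' → Agree k (∂ a) (∂ a')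
Agree-∂ ag i i<k = ag (suc i) (s≤s i<k)

Agree-drop : {A : Set} (d : ℕ) {k : ℕ} {a a' : Stream A} →
             Agree (d + k) a a' → Agree k (λ i → a (d + i)) (λ i → a' (d + i))
Agree-drop d ag i i<k = ag (d + i) (+-monoʳ-< d i<k)

depth : {A V : Set} → T A V → Stream A → ℕ
depth (leaf v)  a = 0
depth (read ts) a = suc (depth (ts (a 0)) (∂ a))

⟨⟩-rest : {A V : Set} (t : T A V) (a : Stream A) →
          ∀ i → proj₂ (⟨ t ⟩ a) i ≡ a (depth t a + i)
⟨⟩-rest (leaf v)  a i = refl
⟨⟩-rest (read ts) a i = ⟨⟩-rest (ts (a 0)) (∂ a) i

⟨⟩-local : {A V : Set} (t : T A V) (a a' : Stream A) → Agree (depth t a) a a' →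
           (proj₁ (⟨ t ⟩ a') ≡ proj₁ (⟨ t ⟩ a)) × (∀ i → proj₂ (⟨ t ⟩ a') i ≡ a' (depth t a + i))
⟨⟩-local (leaf v)  a a' ag = refl , λ i → refl
⟨⟩-local (read ts) a a' ag rewrite Agree-head ag = ⟨⟩-local (ts (a 0)) (∂ a) (∂ a') (Agree-∂ ag)

tr-continuous : {A B S : Set} (γ : S → T A (B × S)) (s : S) → Continuous (tr γ s)
tr-continuous γ s a zero =
  depth (γ s) a , λ a' ag → cong proj₁ (proj₁ (⟨⟩-local (γ s) a a' ag))
tr-continuous γ s a (suc n) with tr-continuous γ (proj₂ (proj₁ (⟨ γ s ⟩ a))) (proj₂ (⟨ γ s ⟩ a)) n
... | k , continuation = d + k , λ a' ag → continuous-at a' ag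
  where
  d : ℕ
  d = depth (γ s) a

  continuous-at : ∀ a' → Agree (d + k) a a' → tr γ s a' (suc n) ≡ tr γ s a (suc n)
  continuous-at a' ag = trans (cong (λ s' → tr γ s' (proj₂ (⟨ γ s ⟩ a')) n) (cong proj₂ same-leaf))
                              (continuation (proj₂ (⟨ γ s ⟩ a')) rests-agree)
    where
    same-leaf : proj₁ (⟨ γ s ⟩ a') ≡ proj₁ (⟨ γ s ⟩ a)
    same-leaf = proj₁ (⟨⟩-local (γ s) a a' (Agree-≤ (m≤m+n d k) ag))

    rests-agree : Agree k (proj₂ (⟨ γ s ⟩ a)) (proj₂ (⟨ γ s ⟩ a'))
    rests-agree i i<k = trans (proj₂ (⟨⟩-local (γ s) a a' (Agree-≤ (m≤m+n d k) ag)) i)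
                              (trans (Agree-drop d ag i i<k) (sym (⟨⟩-rest (γ s) a i)))

trace : {A B S : Set} → (S → T A (B × S)) → S → Top A B
trace γ s = cont (tr γ s) (tr-continuous γ s)

fnP-ext-splitP : {A B X : Set} (f : X → TopP A B) (u : T A X) (a : Stream A) →
                 fnP (ext splitP f u) a ≡ fnP (f (proj₁ (⟨ u ⟩ a))) (proj₂ (⟨ u ⟩ a))
fnP-ext-splitP f (leaf v)  a = refl
fnP-ext-splitP f (read ts) a = fnP-ext-splitP f (ts (a 0)) (∂ a)

Bdot-apply : {A B S : Set} (g : T A S → Top A B) (u : T A (B × S)) (a : Stream A) →
             fnP (Bdot g u) a
               ≡ (proj₁ (proj₁ (⟨ u ⟩ a)) , fn (g (leaf (proj₂ (proj₁ (⟨ u ⟩ a))))) (proj₂ (⟨ u ⟩ a)))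
Bdot-apply g = fnP-ext-splitP (λ bs → ι (proj₁ bs) (g (leaf (proj₂ bs))))

IsMagmaHom⇒≈ext : {A B S : Set} (g : T A S → Top A B) (f : S → Top A B) →
                  IsMagmaHom g → (∀ s → g (leaf s) ≈ f s) → ∀ t → g t ≈ ext split f t
IsMagmaHom⇒≈ext g f hom leaves (leaf s)  a n = leaves s a n
IsMagmaHom⇒≈ext g f hom leaves (read ts) a n =
  trans (hom ts a n) (IsMagmaHom⇒≈ext g f hom leaves (ts (a 0)) (∂ a) n)

module _ {A B S : Set} (γ : S → T A (B × S)) where

  δ-compatible-on-leaves⇒δ-compatible :
    (g : T A S → Top A B) → IsMagmaHom g → (∀ s → δE (g (leaf s)) ≈P Bdot g (γ s)) →
    ∀ t → δE (g t) ≈P Bdot g (δT γ t)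
  δ-compatible-on-leaves⇒δ-compatible g hom leaves (leaf s) a = leaves s a
  δ-compatible-on-leaves⇒δ-compatible g hom leaves (read ts) a
    with δ-compatible-on-leaves⇒δ-compatible g hom leaves (ts (a 0)) (∂ a)
  ... | head , tail = trans (hom ts a 0) head , λ n → trans (hom ts a (suc n)) (tail n)

  tr† : T A S → Top A B
  tr† = ext split (trace γ)

  tr†-δ-compatible-on-leaves : ∀ s → δE (tr† (leaf s)) ≈P Bdot tr† (γ s)
  tr†-δ-compatible-on-leaves s a =
    sym (cong proj₁ (Bdot-apply tr† (γ s) a)) , λ n → sym (cong (λ p → proj₂ p n) (Bdot-apply tr† (γ s) a))

  δ-compatible-on-leaves⇒≈trace :
    (g : T A S → Top A B) → (∀ s → δE (g (leaf s)) ≈P Bdot g (γ s)) → ∀ s → g (leaf s) ≈ trace γ s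
  δ-compatible-on-leaves⇒≈trace g leaves s a zero =
    trans (proj₁ (leaves s a)) (cong proj₁ (Bdot-apply g (γ s) a))
  δ-compatible-on-leaves⇒≈trace g leaves s a (suc n) =
    trans (proj₂ (leaves s a) n)
          (trans (cong (λ p → proj₂ p n) (Bdot-apply g (γ s) a))
                 (δ-compatible-on-leaves⇒≈trace g leaves (proj₂ (proj₁ (⟨ γ s ⟩ a))) (proj₂ (⟨ γ s ⟩ a)) n))

proposition6p3 : (A B S : Set) (γ : S → T A (B × S)) →
    Σ ((s : S) → Continuous (tr γ s)) (λ trc →
      IsBimodelMap γ (ext split (λ s → cont (tr γ s) (trc s)))
      × (∀ (g : T A S → Top A B) → IsBimodelMap γ g →
           ∀ t → g t ≈ ext split (λ s → cont (tr γ s) (trc s)) t))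
proposition6p3 A B S γ = tr-continuous γ , (tr†-hom , tr†-δ) , unique
  where
  tr†-hom : IsMagmaHom (tr† γ)
  tr†-hom ts a n = refl

  tr†-δ : ∀ t → δE (tr† γ t) ≈P Bdot (tr† γ) (δT γ t)
  tr†-δ = δ-compatible-on-leaves⇒δ-compatible γ (tr† γ) tr†-hom (tr†-δ-compatible-on-leaves γ)

  unique : ∀ g → IsBimodelMap γ g → ∀ t → g t ≈ tr† γ t
  unique g (hom , δ-compatible) =
    IsMagmaHom⇒≈ext g (trace γ) hom (δ-compatible-on-leaves⇒≈trace γ g (λ s → δ-compatible (leaf s)))
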